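{- Let $P$ be a finite poset, $r\geq 1$. (1) For every strictly increasing $\imath:[r]\to[2r]$, the relation $\preceq_\imath$ on $P_r$ is antisymmetric. (2) The relation $\preceq_\imath$ is a partial order on $P_r$ for all strictly increasing $\imath:[r]\to[2r]$ if and only if either $r=1$ or $P$ is an antichain.
   Context: For a natural number $n$, $[n]=\{1,\dots,n\}$. $P_r$ denotes the set of all $r$-multichains $\mathfrak{p}: p_1\leq\cdots\leq p_r$ in $P$. For strictly increasing $\imath:[r]\to[2r]$, $\mathfrak{p}\preceq_\imath\mathfrak{q}$ (for $\mathfrak{p}: p_1\leq\cdots\leq p_r$, $\mathfrak{q}: q_1\leq\cdots\leq q_r$) means: for all $t,s\in[r]$, $p_t\geq q_s$ whenever $s\leq\imath(t)-t$ and $p_t\leq q_s$ whenever $s>\imath(t)-t$. -}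

module Defs where

open import Level using (Level; _⊔_)
open import Data.Nat using (ℕ; _∸_; _*_) renaming (_≤_ to _≤ℕ_; _<_ to _<ℕ_)
open import Data.Fin using (Fin; toℕ) renaming (_≤_ to _≤ᶠ_; _<_ to _<ᶠ_)
open import Data.Product using (Σ; _×_; proj₁)
open import Relation.Binary.Core using (Rel)
open import Relation.Binary.PropositionalEquality using (_≡_)

-- A finite poset is represented (up to isomorphism) as a partial order
-- _≤_ on Fin n with respect to propositional equality.

StrictlyIncreasing : {r : ℕ} → (Fin r → Fin (2 * r)) → Set
StrictlyIncreasing {r} ı = ∀ {i j : Fin r} → i <ᶠ j → ı i <ᶠ ı j

Multichain : ∀ {ℓ} {n : ℕ} → Rel (Fin n) ℓ → ℕ → Set ℓ
Multichain {n = n} _≤_ r = Σ (Fin r → Fin n) λ f → ∀ {i j : Fin r} → i ≤ᶠ j → f i ≤ f j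

_≈MC_ : ∀ {ℓ} {n : ℕ} {_≤_ : Rel (Fin n) ℓ} {r : ℕ} → Rel (Multichain _≤_ r) _
𝔭 ≈MC 𝔮 = ∀ i → proj₁ 𝔭 i ≡ proj₁ 𝔮 i

-- With 1-indexed s,t the paper's condition "s ≤ ı(t) − t" becomes,
-- for 0-indexed s', t' and ı' (ı' t' = ı(t'+1) − 1), "s' + 1 ≤ ı' t' ∸ t'",
-- i.e. s' < ı' t' ∸ t'; its negation is ı' t' ∸ t' ≤ s'.
Prec : ∀ {ℓ} {n : ℕ} (_≤_ : Rel (Fin n) ℓ) {r : ℕ} → (Fin r → Fin (2 * r)) →
       Rel (Multichain _≤_ r) ℓ
Prec _≤_ ı 𝔭 𝔮 =
  ∀ (t s : Fin _) →
    (toℕ s <ℕ toℕ (ı t) ∸ toℕ t → proj₁ 𝔮 s ≤ proj₁ 𝔭 t) ×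
    (toℕ (ı t) ∸ toℕ t ≤ℕ toℕ s → proj₁ 𝔭 t ≤ proj₁ 𝔮 s)

IsAntichain : ∀ {ℓ} {n : ℕ} → Rel (Fin n) ℓ → Set ℓ
IsAntichain {n = n} _≤_ = ∀ (x y : Fin n) → x ≤ y → x ≡ y

-- The diagonal pairs (t, t) of 𝔭 ⪯ᵢ 𝔮 and 𝔮 ⪯ᵢ 𝔭 compare pₜ and qₜ in both
-- directions, which gives antisymmetry. For r = 1 the diagonal pair is the only
-- pair, so ⪯ᵢ is just ≤ or ≥ on P. On an antichain every multichain is
-- constant and 𝔭 ⪯ᵢ 𝔮 says that both chains are the same constant. Conversely,
-- for r ≥ 2 take ı(t) = t + 2: reflexivity of ⪯ᵢ at the multichain
-- x ≤ y ≤ ⋯ ≤ y forces y ≤ x, so P is an antichain.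
module Submission where

open import Defs
open import Data.Nat using (ℕ; zero; suc; _*_; _+_; _∸_; _≤_; _<?_; z≤n; s≤s)
open import Data.Nat.Properties using (≮⇒≥; +-monoˡ-≤; +-identityʳ)
open import Data.Fin using (Fin; toℕ; inject≤; _↑ʳ_) renaming (zero to fzero; suc to fsuc; _≤_ to _≤ᶠ_)
open import Data.Fin.Properties using (≤-total; toℕ-inject≤; toℕ-↑ʳ)
open import Data.Product using (_×_; _,_; proj₁; proj₂)
open import Data.Sum using (_⊎_; inj₁; inj₂)
open import Function.Bundles using (_⇔_; mk⇔)
open import Relation.Nullary using (yes; no)
open import Relation.Binary.Core using (Rel)
open import Relation.Binary.Definitions using (Reflexive; Antisymmetric)
open import Relation.Binary.Structures using (IsEquivalence; IsPartialOrder)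
open import Relation.Binary.PropositionalEquality
  using (_≡_; refl; sym; trans; cong; subst)

shift₂ : ∀ {r} → 2 ≤ r → Fin r → Fin (2 * r)
shift₂ {r} 2≤r t = inject≤ (2 ↑ʳ t) 2+r≤2*r
  where
  2+r≤2*r : 2 + r ≤ 2 * r
  2+r≤2*r = subst (2 + r ≤_) (cong (r +_) (sym (+-identityʳ r))) (+-monoˡ-≤ r 2≤r)

toℕ-shift₂ : ∀ {r} (2≤r : 2 ≤ r) (t : Fin r) → toℕ (shift₂ 2≤r t) ≡ 2 + toℕ t
toℕ-shift₂ 2≤r t = trans (toℕ-inject≤ (2 ↑ʳ t) _) (toℕ-↑ʳ 2 t)

shift₂-strictlyIncreasing : ∀ {r} (2≤r : 2 ≤ r) → StrictlyIncreasing (shift₂ 2≤r)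
shift₂-strictlyIncreasing 2≤r {i} {j} i<j
  rewrite toℕ-shift₂ 2≤r i | toℕ-shift₂ 2≤r j = s≤s (s≤s i<j)

module _ {ℓ} {n : ℕ} (_⊑_ : Rel (Fin n) ℓ) where

  ≈MC-isEquivalence : ∀ {r} → IsEquivalence (_≈MC_ {_≤_ = _⊑_} {r})
  ≈MC-isEquivalence = record
    { refl  = λ _ → refl
    ; sym   = λ p≈q i → sym (p≈q i)
    ; trans = λ p≈q q≈w i → trans (p≈q i) (q≈w i)
    }

  Prec-antisym : Antisymmetric _≡_ _⊑_ → ∀ {r} (ı : Fin r → Fin (2 * r)) →
                 Antisymmetric (_≈MC_ {_≤_ = _⊑_}) (Prec _⊑_ ı)
  Prec-antisym antisym ı p⪯q q⪯p t with toℕ t <? toℕ (ı t) ∸ toℕ t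
  ... | yes t<k = antisym (proj₁ (q⪯p t t) t<k) (proj₁ (p⪯q t t) t<k)
  ... | no  t≮k = antisym (proj₂ (p⪯q t t) (≮⇒≥ t≮k)) (proj₂ (q⪯p t t) (≮⇒≥ t≮k))

  Prec-refl⇒antichain : ∀ {m} (ı : Fin (2 + m) → Fin (2 * (2 + m))) → 2 ≤ toℕ (ı fzero) →
                        Reflexive _⊑_ → (∀ 𝔭 → Prec _⊑_ ı 𝔭 𝔭) →
                        Antisymmetric _≡_ _⊑_ → IsAntichain _⊑_
  Prec-refl⇒antichain {m} ı 2≤ı₀ ⊑-refl ⪯-refl antisym x y x⊑y =
    antisym x⊑y (proj₁ (⪯-refl (step , step-mono) fzero (fsuc fzero)) 2≤ı₀)
    where
    step : Fin (2 + m) → Fin n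
    step fzero    = x
    step (fsuc _) = y

    step-mono : ∀ {i j} → i ≤ᶠ j → step i ⊑ step j
    step-mono {fzero}  {fzero}  _ = ⊑-refl
    step-mono {fzero}  {fsuc _} _ = x⊑y
    step-mono {fsuc _} {fzero}  ()
    step-mono {fsuc _} {fsuc _} _ = ⊑-refl

  module _ (po : IsPartialOrder _≡_ _⊑_) where
    open IsPartialOrder po using (antisym)
      renaming (refl to ⊑-refl; reflexive to ⊑-reflexive; trans to ⊑-trans)

    Prec-isPartialOrder-1 : (ı : Fin 1 → Fin 2) →
                            IsPartialOrder (_≈MC_ {_≤_ = _⊑_}) (Prec _⊑_ ı)
    Prec-isPartialOrder-1 ı = record
      { isPreorder = record
        { isEquivalence = ≈MC-isEquivalence
        ; reflexive     = λ { p≈q fzero fzero → (λ _ → ⊑-reflexive (sym (p≈q fzero)))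
                                              , (λ _ → ⊑-reflexive (p≈q fzero)) }
        ; trans         = λ { p⪯q q⪯w fzero fzero →
                                (λ h → ⊑-trans (proj₁ (q⪯w fzero fzero) h) (proj₁ (p⪯q fzero fzero) h))
                              , (λ h → ⊑-trans (proj₂ (p⪯q fzero fzero) h) (proj₂ (q⪯w fzero fzero) h)) }
        }
      ; antisym = λ {𝔭} {𝔮} → Prec-antisym antisym ı {𝔭} {𝔮}
      }

    module _ (antichain : IsAntichain _⊑_) {r : ℕ} (ı : Fin r → Fin (2 * r)) where

      Multichain-constant : (𝔭 : Multichain _⊑_ r) → ∀ t s → proj₁ 𝔭 t ≡ proj₁ 𝔭 s
      Multichain-constant 𝔭 t s with ≤-total t s
      ... | inj₁ t≤s = antichain _ _ (proj₂ 𝔭 t≤s)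
      ... | inj₂ s≤t = sym (antichain _ _ (proj₂ 𝔭 s≤t))

      Prec⇒allEqual : ∀ 𝔭 𝔮 → Prec _⊑_ ı 𝔭 𝔮 → ∀ t s → proj₁ 𝔭 t ≡ proj₁ 𝔮 s
      Prec⇒allEqual _ _ 𝔭⪯𝔮 t s with toℕ s <? toℕ (ı t) ∸ toℕ t
      ... | yes s<k = sym (antichain _ _ (proj₁ (𝔭⪯𝔮 t s) s<k))
      ... | no  s≮k = antichain _ _ (proj₂ (𝔭⪯𝔮 t s) (≮⇒≥ s≮k))

      allEqual⇒Prec : ∀ 𝔭 𝔮 → (∀ t s → proj₁ 𝔭 t ≡ proj₁ 𝔮 s) → Prec _⊑_ ı 𝔭 𝔮
      allEqual⇒Prec _ _ p≡q t s = (λ _ → ⊑-reflexive (sym (p≡q t s))) , (λ _ → ⊑-reflexive (p≡q t s))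

      Prec-isPartialOrder-antichain : IsPartialOrder (_≈MC_ {_≤_ = _⊑_}) (Prec _⊑_ ı)
      Prec-isPartialOrder-antichain = record
        { isPreorder = record
          { isEquivalence = ≈MC-isEquivalence
          ; reflexive     = λ {𝔭} {𝔮} p≈q → allEqual⇒Prec 𝔭 𝔮 λ t s →
                              trans (Multichain-constant 𝔭 t s) (p≈q s)
          ; trans         = λ {𝔭} {𝔮} {𝔴} p⪯q q⪯w → allEqual⇒Prec 𝔭 𝔴 λ t s →
                              trans (Prec⇒allEqual 𝔭 𝔮 p⪯q t t) (Prec⇒allEqual 𝔮 𝔴 q⪯w t s)
          }
        ; antisym = λ {𝔭} {𝔮} → Prec-antisym antisym ı {𝔭} {𝔮}
        }

    allPartialOrders⇒r≡1⊎antichain : ∀ r → 1 ≤ r →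
      ((ı : Fin r → Fin (2 * r)) → StrictlyIncreasing ı →
        IsPartialOrder (_≈MC_ {_≤_ = _⊑_}) (Prec _⊑_ ı)) →
      r ≡ 1 ⊎ IsAntichain _⊑_
    allPartialOrders⇒r≡1⊎antichain zero          () _
    allPartialOrders⇒r≡1⊎antichain (suc zero)    _  _    = inj₁ refl
    allPartialOrders⇒r≡1⊎antichain (suc (suc m)) _  po-ı =
      inj₂ (Prec-refl⇒antichain ı 2≤ı₀ ⊑-refl (λ 𝔭 → IsPartialOrder.refl (po-ı ı ı-incr) {𝔭}) antisym)
      where
      2≤r : 2 ≤ 2 + m
      2≤r = s≤s (s≤s z≤n)
      ı : Fin (2 + m) → Fin (2 * (2 + m))
      ı = shift₂ 2≤r
      ı-incr : StrictlyIncreasing ı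
      ı-incr = shift₂-strictlyIncreasing 2≤r
      2≤ı₀ : 2 ≤ toℕ (ı fzero)
      2≤ı₀ = subst (2 ≤_) (sym (toℕ-shift₂ 2≤r fzero)) (s≤s (s≤s z≤n))

lemma2p2 : ∀ {ℓ} (n : ℕ) (_⊑_ : Rel (Fin n) ℓ) → IsPartialOrder _≡_ _⊑_ →
    (r : ℕ) → 1 ≤ r →
    ((ı : Fin r → Fin (2 * r)) → StrictlyIncreasing ı →
      Antisymmetric (_≈MC_ {_≤_ = _⊑_}) (Prec _⊑_ ı))
    ×
    (((ı : Fin r → Fin (2 * r)) → StrictlyIncreasing ı →
        IsPartialOrder (_≈MC_ {_≤_ = _⊑_}) (Prec _⊑_ ı))
      ⇔ (r ≡ 1 ⊎ IsAntichain _⊑_))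
lemma2p2 n _⊑_ po r 1≤r =
  (λ ı _ {𝔭} {𝔮} → Prec-antisym _⊑_ (IsPartialOrder.antisym po) ı {𝔭} {𝔮}) ,
  mk⇔ (allPartialOrders⇒r≡1⊎antichain _⊑_ po r 1≤r) partialOrders
  where
  partialOrders : r ≡ 1 ⊎ IsAntichain _⊑_ → (ı : Fin r → Fin (2 * r)) → StrictlyIncreasing ı →
                  IsPartialOrder (_≈MC_ {_≤_ = _⊑_}) (Prec _⊑_ ı)
  partialOrders (inj₁ refl)      ı _ = Prec-isPartialOrder-1 _⊑_ po ı
  partialOrders (inj₂ antichain) ı _ = Prec-isPartialOrder-antichain _⊑_ po antichain ı
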